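{- The following two statements are equivalent. (i) (Woodall's conjecture) In every digraph, the minimum size of a dicut equals the maximum number of pairwise arc-disjoint dijoins. (ii) For every undirected graph $G=(V,E)$ and every integer $\tau>0$, every nowhere-zero $\tau$-SCO $x$ of $G$ can be written as $x=\sum_{i=1}^{\tau}\chi_{O_i}$ where each $O_i$ is a strongly connected orientation of $G$.
   Context: In a digraph $D=(V,A)$, a dicut is an arc set $\delta^+_D(U)$ (arcs leaving $U$) with $\emptyset\neq U\subsetneq V$ and no arc entering $U$; a dijoin is an arc set meeting every dicut. For an undirected graph $G=(V,E)$, let $\vec G=(V,E^+\cup E^-)$ be obtained by replacing each edge $e=\{u,v\}$ by two arcs $e^+=(u,v)$ and $e^-=(v,u)$. An orientation of $G$ is a set $O\subseteq E^+\cup E^-$ containing exactly one of $e^+,e^-$ for each $e$; it is a strongly connected orientation (SCO) if for every $\emptyset\ne U\subsetneq V$ some arc of $O$ leaves $U$; $\chi_O$ is its characteristic vector. A nowhere-zero $\tau$-SCO of $G$ is an integer vector $x\in\mathbb{Z}^{E^+\cup E^- }$ with $x_{e^+}\ge1$, $x_{e^- }\ge 1$ and $x_{e^+}+x_{e^- }=\tau$ for every $e\in E$, and $x(\delta^+_{\vec G}(U))\ge\tau$ for every $\emptyset\ne U\subsetneq V$, where $\delta^+_{\vec G}(U)$ is the set of arcs of $\vec G$ leaving $U$ and $x(F)=\sum_{a\in F}x_a$. -}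

module Defs where

open import Data.Nat using (ℕ; zero; suc; _+_; _≤_; _≥_; _>_)
open import Data.Bool using (Bool; true; false; if_then_else_; _∧_; not)
open import Data.Vec using (lookup)
open import Data.Fin using (Fin; zero; suc)
open import Data.Fin.Subset using (Subset; _∈_; _∉_; ∣_∣)
open import Data.Product using (Σ; ∃; _×_; _,_)
open import Relation.Binary.PropositionalEquality using (_≡_; _≢_)
open import Relation.Nullary using (¬_)
open import Function.Bundles using (_⇔_)

Σ[<_]_ : (k : ℕ) → (Fin k → ℕ) → ℕ
Σ[< zero ] f = 0
Σ[< suc k ] f = f zero + Σ[< k ] (λ i → f (suc i))

NonTrivial : {n : ℕ} → Subset n → Set
NonTrivial U = (∃ λ v → v ∈ U) × (∃ λ w → w ∉ U)

-- Digraphs (finite, parallel arcs allowed): vertices Fin n, arcs Fin m,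
-- arc a goes from tail a to head a.

record Digraph : Set where
  field
    n m  : ℕ
    tail : Fin m → Fin n
    head : Fin m → Fin n

module _ (D : Digraph) where
  open Digraph D

  Leaves : Fin m → Subset n → Set
  Leaves a U = (tail a ∈ U) × (head a ∉ U)

  Enters : Fin m → Subset n → Set
  Enters a U = (tail a ∉ U) × (head a ∈ U)

  IsDicut : Subset m → Set
  IsDicut C = Σ (Subset n) λ U → NonTrivial U × (∀ a → ¬ Enters a U)
                × (∀ a → (a ∈ C → Leaves a U) × (Leaves a U → a ∈ C))

  IsDijoin : Subset m → Set
  IsDijoin J = ∀ C → IsDicut C → ∃ λ a → (a ∈ C) × (a ∈ J)

  DisjointDijoins : ℕ → Set
  DisjointDijoins k = Σ (Fin k → Subset m) λ J →
    (∀ i → IsDijoin (J i)) × (∀ i j → i ≢ j → ∀ a → a ∈ J i → a ∉ J j)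

  -- min dicut size = max number of pairwise arc-disjoint dijoins
  -- (with a minimum dicut C: the max exists and equals ∣ C ∣).
  MinDicutEqualsMaxDijoins : Set
  MinDicutEqualsMaxDijoins =
    Σ (Subset m) λ C → IsDicut C × (∀ C' → IsDicut C' → ∣ C ∣ ≤ ∣ C' ∣)
      × DisjointDijoins ∣ C ∣
      × (∀ k → DisjointDijoins k → k ≤ ∣ C ∣)

HasDicut : Digraph → Set
HasDicut D = ∃ λ C → IsDicut D C

WoodallConjecture : Set
WoodallConjecture = (D : Digraph) → HasDicut D → MinDicutEqualsMaxDijoins D

-- Undirected (multi)graphs: edge e = {u e, v e}.  Arcs of G⃗ are pairs
-- (e , s) with s = true for e⁺ = (u e, v e), s = false for e⁻ = (v e, u e).

record Graph : Set where
  field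
    n m : ℕ
    u v : Fin m → Fin n

module _ (G : Graph) where
  open Graph G

  arcTail : Fin m → Bool → Fin n
  arcTail e true  = u e
  arcTail e false = v e

  arcHead : Fin m → Bool → Fin n
  arcHead e true  = v e
  arcHead e false = u e

  LeavesG : Fin m → Bool → Subset n → Set
  LeavesG e s U = (arcTail e s ∈ U) × (arcHead e s ∉ U)

  -- O ⊆ E⁺ ∪ E⁻ given by its membership predicate O e s
  IsOrientation : (Fin m → Bool → Bool) → Set
  IsOrientation O = ∀ e → O e true ≢ O e false

  IsSCO : (Fin m → Bool → Bool) → Set
  IsSCO O = IsOrientation O ×
    (∀ U → NonTrivial U → Σ (Fin m) λ e → Σ Bool λ s → (O e s ≡ true) × LeavesG e s U)

  χ : (Fin m → Bool → Bool) → Fin m → Bool → ℕ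
  χ O e s = if O e s then 1 else 0

  outValue : (Fin m → Bool → ℕ) → Subset n → ℕ
  outValue x U = Σ[< m ] (λ e → val e true + val e false)
    where
    val : Fin m → Bool → ℕ
    val e s = if lookup U (arcTail e s) ∧ not (lookup U (arcHead e s)) then x e s else 0

  -- nowhere-zero τ-SCO (x takes values ≥ 1, so ℕ-valued is no loss)
  IsNZτSCO : ℕ → (Fin m → Bool → ℕ) → Set
  IsNZτSCO τ x = (∀ e s → x e s ≥ 1) × (∀ e → x e true + x e false ≡ τ)
    × (∀ U → NonTrivial U → outValue x U ≥ τ)

  DecomposesIntoSCOs : ℕ → (Fin m → Bool → ℕ) → Set
  DecomposesIntoSCOs τ x = Σ (Fin τ → Fin m → Bool → Bool) λ O →
    (∀ i → IsSCO (O i)) × (∀ e s → x e s ≡ Σ[< τ ] (λ i → χ (O i) e s))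

SCODecomposition : Set
SCODecomposition = (G : Graph) → (τ : ℕ) → τ > 0 → (x : Fin (Graph.m G) → Bool → ℕ) →
  IsNZτSCO G τ x → DecomposesIntoSCOs G τ x

-- (ii) ⇒ (i). Disjoint dijoins meet a dicut in distinct arcs, so at most |C| of them exist.
-- Conversely, if every dicut has at least τ ≥ 2 arcs, weight each arc of D by τ − 1 forwards
-- and 1 backwards in the underlying graph: this is a nowhere-zero τ-SCO, and the arcs that the
-- i-th orientation of its decomposition reverses form the i-th dijoin.
--
-- (i) ⇒ (ii). Subdivide each edge e by a new node sending x(e⁺) parallel arcs to v(e) and
-- x(e⁻) to u(e). By the cut condition on x every dicut of this digraph has at least τ arcs,
-- so Woodall's conjecture yields τ disjoint dijoins. The i-th dijoin meets the star of each
-- edge node; counting against x(e⁺) + x(e⁻) = τ shows that it does so on exactly one side,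
-- which orients e. Since the dijoin also meets the dicut leaving U together with all edge
-- nodes touching U, the i-th orientation is strongly connected.

module Submission where

open import Defs
open import Function.Bundles using (_⇔_; mk⇔; Equivalence)

open import Data.Nat using (ℕ; zero; suc; _+_; _*_; _≤_; _<_; _≥_; _>_; z≤n; s≤s; _<ᵇ_)
open import Data.Nat.Properties using (≤-refl; ≤-reflexive; ≤-trans; ≤-antisym; ≤-pred; ≤-<-trans; <⇒≤; ≮⇒≥; n≮n; _<?_; +-comm; +-assoc; +-identityʳ; *-identityʳ; *-zeroʳ; *-distribˡ-+; +-mono-≤; +-monoˡ-≤; +-monoʳ-≤; *-monoʳ-≤; m≤m+n; m≤n+m; m≤n*m; m<m+n; +-cancelˡ-≤; +-cancelʳ-≤; +-cancelˡ-≡; +-commutativeSemigroup; module ≤-Reasoning)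
open import Data.Bool using (Bool; true; false; if_then_else_; _∧_; _∨_; not)
open import Data.Bool.Properties using (∧-conicalˡ; ∧-conicalʳ; ∨-zeroʳ; not-¬) renaming (_≟_ to _≟ᵇ_)
open import Data.Fin using (Fin; zero; suc; toℕ; fromℕ<; _↑ˡ_; _↑ʳ_; combine; quotient; remainder; splitAt; inject≤)
open import Data.Fin.Properties using (any?; all?; _≟_; suc-injective; inject≤-injective; toℕ-fromℕ<; ↑ʳ-injective; splitAt-↑ˡ; splitAt-↑ʳ; splitAt⁻¹-↑ˡ; splitAt⁻¹-↑ʳ; remQuot-combine; combine-remQuot)
open import Data.Fin.Subset using (Subset; _∈_; _∉_; ∣_∣; ∁; ⊤; ⁅_⁆)
open import Data.Fin.Subset.Properties using (Empty-unique; ∣⊥∣≡0; x∈p⇒x∉∁p; _∈?_; nonempty?; anySubset?; x∈∁p⇒x∉p; x∉p⇒x∈∁p; x∉∁p⇒x∈p; ∈⊤; x∈⁅x⁆; x∈⁅y⁆⇒x≡y)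
open import Data.Vec using ([]; _∷_; lookup; tabulate; _++_)
open import Data.Vec.Properties using (lookup-map; []=⇒lookup; lookup⇒[]=; lookup∘tabulate; lookup-++ˡ; lookup-++ʳ)
open import Data.Product using (Σ; ∃; _×_; _,_; proj₁; proj₂)
open import Data.Sum using (_⊎_; inj₁; inj₂)
open import Relation.Binary.PropositionalEquality using (_≡_; _≢_; refl; sym; trans; cong; cong₂; subst; module ≡-Reasoning)
open import Relation.Nullary using (¬_; Dec; yes; no; does; ¬?; _×-dec_; contradiction)
open import Relation.Nullary.Decidable using (dec-true; dec-false; decidable-stable)
open import Algebra.Properties.CommutativeSemigroup +-commutativeSemigroup using (interchange)

χᵇ : Bool → ℕ
χᵇ b = if b then 1 else 0

χᵇ-mono : ∀ {a b} → (a ≡ true → b ≡ true) → χᵇ a ≤ χᵇ b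
χᵇ-mono {false} _ = z≤n
χᵇ-mono {true} a⇒b rewrite a⇒b refl = ≤-refl

χᵇ-injective : ∀ {a b} → χᵇ a ≡ χᵇ b → a ≡ b
χᵇ-injective {false} {false} _ = refl
χᵇ-injective {true} {true} _ = refl

χᵇ+χᵇ-not : ∀ b → χᵇ b + χᵇ (not b) ≡ 1
χᵇ+χᵇ-not true = refl
χᵇ+χᵇ-not false = refl

if-then-0≡*χᵇ : ∀ b c → (if b then c else 0) ≡ c * χᵇ b
if-then-0≡*χᵇ true c = sym (*-identityʳ c)
if-then-0≡*χᵇ false c = sym (*-zeroʳ c)

Σ-cong : ∀ k {f g : Fin k → ℕ} → (∀ i → f i ≡ g i) → Σ[< k ] f ≡ Σ[< k ] g
Σ-cong zero _ = refl
Σ-cong (suc k) f≗g = cong₂ _+_ (f≗g zero) (Σ-cong k (λ i → f≗g (suc i)))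

Σ-mono : ∀ k {f g : Fin k → ℕ} → (∀ i → f i ≤ g i) → Σ[< k ] f ≤ Σ[< k ] g
Σ-mono zero _ = z≤n
Σ-mono (suc k) f≤g = +-mono-≤ (f≤g zero) (Σ-mono k (λ i → f≤g (suc i)))

Σ-0 : ∀ k → Σ[< k ] (λ _ → 0) ≡ 0
Σ-0 zero = refl
Σ-0 (suc k) = Σ-0 k

Σ-1 : ∀ k → Σ[< k ] (λ _ → 1) ≡ k
Σ-1 zero = refl
Σ-1 (suc k) = cong suc (Σ-1 k)

Σ-distrib-+ : ∀ k (f g : Fin k → ℕ) → Σ[< k ] (λ i → f i + g i) ≡ Σ[< k ] f + Σ[< k ] g
Σ-distrib-+ zero f g = refl
Σ-distrib-+ (suc k) f g =
  trans (cong (f zero + g zero +_) (Σ-distrib-+ k (λ i → f (suc i)) (λ i → g (suc i))))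
        (interchange (f zero) (g zero) _ _)

Σ-distribˡ-* : ∀ k c (f : Fin k → ℕ) → Σ[< k ] (λ i → c * f i) ≡ c * Σ[< k ] f
Σ-distribˡ-* zero c f = sym (*-zeroʳ c)
Σ-distribˡ-* (suc k) c f =
  trans (cong (c * f zero +_) (Σ-distribˡ-* k c (λ i → f (suc i)))) (sym (*-distribˡ-+ c (f zero) _))

Σ-comm : ∀ k l (f : Fin k → Fin l → ℕ) →
         Σ[< k ] (λ i → Σ[< l ] (f i)) ≡ Σ[< l ] (λ j → Σ[< k ] (λ i → f i j))
Σ-comm zero l f = sym (Σ-0 l)
Σ-comm (suc k) l f =
  trans (cong (Σ[< l ] (f zero) +_) (Σ-comm k l (λ i → f (suc i))))
        (sym (Σ-distrib-+ l (f zero) _))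

Σ-++ : ∀ a b (f : Fin (a + b) → ℕ) →
       Σ[< a + b ] f ≡ Σ[< a ] (λ i → f (i ↑ˡ b)) + Σ[< b ] (λ j → f (a ↑ʳ j))
Σ-++ zero b f = refl
Σ-++ (suc a) b f = trans (cong (f zero +_) (Σ-++ a b (λ i → f (suc i)))) (sym (+-assoc (f zero) _ _))

Σ-combine : ∀ a b (f : Fin (a * b) → ℕ) → Σ[< a * b ] f ≡ Σ[< a ] (λ i → Σ[< b ] (λ j → f (combine i j)))
Σ-combine zero b f = refl
Σ-combine (suc a) b f =
  trans (Σ-++ b (a * b) f) (cong (Σ[< b ] (λ j → f (j ↑ˡ (a * b))) +_) (Σ-combine a b (λ i → f (b ↑ʳ i))))

Σ-≥-term : ∀ k (f : Fin k → ℕ) i → f i ≤ Σ[< k ] f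
Σ-≥-term (suc k) f zero = m≤m+n (f zero) _
Σ-≥-term (suc k) f (suc i) = ≤-trans (Σ-≥-term k (λ j → f (suc j)) i) (m≤n+m _ (f zero))

Σ-≥-two-terms : ∀ k (f : Fin k → ℕ) {i j} → i ≢ j → f i + f j ≤ Σ[< k ] f
Σ-≥-two-terms (suc k) f {zero} {zero} i≢j = contradiction refl i≢j
Σ-≥-two-terms (suc k) f {zero} {suc j} _ = +-monoʳ-≤ (f zero) (Σ-≥-term k (λ x → f (suc x)) j)
Σ-≥-two-terms (suc k) f {suc i} {zero} _ =
  subst (_≤ Σ[< suc k ] f) (+-comm (f zero) (f (suc i))) (+-monoʳ-≤ (f zero) (Σ-≥-term k (λ x → f (suc x)) i))
Σ-≥-two-terms (suc k) f {suc i} {suc j} si≢sj =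
  ≤-trans (Σ-≥-two-terms k (λ x → f (suc x)) (λ i≡j → si≢sj (cong suc i≡j))) (m≤n+m _ (f zero))

Σ-positive : ∀ k (f : Fin k → ℕ) → 0 < Σ[< k ] f → ∃ λ i → 0 < f i
Σ-positive (suc k) f 0<Σ with f zero in eq
... | suc _ = zero , subst (0 <_) (sym eq) (s≤s z≤n)
... | zero with Σ-positive k (λ i → f (suc i)) 0<Σ
...   | i , 0<fi = suc i , 0<fi

+-mono-≤-tight : ∀ {a b c d} → a ≤ c → b ≤ d → c + d ≤ a + b → a ≡ c × b ≡ d
+-mono-≤-tight {a} {b} {c} {d} a≤c b≤d c+d≤a+b =
  ≤-antisym a≤c (+-cancelʳ-≤ d c a (≤-trans c+d≤a+b (+-monoʳ-≤ a b≤d))) ,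
  ≤-antisym b≤d (+-cancelˡ-≤ c d b (≤-trans c+d≤a+b (+-monoˡ-≤ b a≤c)))

Σ-mono-tight : ∀ k {f g : Fin k → ℕ} → (∀ i → f i ≤ g i) → Σ[< k ] g ≤ Σ[< k ] f → ∀ i → f i ≡ g i
Σ-mono-tight (suc k) f≤g Σg≤Σf zero = proj₁ (+-mono-≤-tight (f≤g zero) (Σ-mono k (λ i → f≤g (suc i))) Σg≤Σf)
Σ-mono-tight (suc k) f≤g Σg≤Σf (suc i) =
  Σ-mono-tight k (λ j → f≤g (suc j))
    (≤-reflexive (sym (proj₂ (+-mono-≤-tight (f≤g zero) (Σ-mono k (λ j → f≤g (suc j))) Σg≤Σf)))) i

Σ-χᵇ-<ᵇ : ∀ t c → c ≤ t → Σ[< t ] (λ k → χᵇ (toℕ k <ᵇ c)) ≡ c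
Σ-χᵇ-<ᵇ t zero _ = Σ-0 t
Σ-χᵇ-<ᵇ (suc t) (suc c) (s≤s c≤t) = cong suc (Σ-χᵇ-<ᵇ t c c≤t)

Σ-χᵇ+Σ-χᵇ-not : ∀ k (p : Fin k → Bool) → Σ[< k ] (λ i → χᵇ (p i)) + Σ[< k ] (λ i → χᵇ (not (p i))) ≡ k
Σ-χᵇ+Σ-χᵇ-not k p = begin
  Σ[< k ] (λ i → χᵇ (p i)) + Σ[< k ] (λ i → χᵇ (not (p i))) ≡⟨ Σ-distrib-+ k _ _ ⟨
  Σ[< k ] (λ i → χᵇ (p i) + χᵇ (not (p i)))                 ≡⟨ Σ-cong k (λ i → χᵇ+χᵇ-not (p i)) ⟩
  Σ[< k ] (λ _ → 1)                                         ≡⟨ Σ-1 k ⟩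
  k                                                         ∎
  where open ≡-Reasoning


∃ᵇ : ∀ {k} → (Fin k → Bool) → Bool
∃ᵇ p = does (any? λ i → p i ≟ᵇ true)

∃ᵇ-intro : ∀ {k} (p : Fin k → Bool) {i} → p i ≡ true → ∃ᵇ p ≡ true
∃ᵇ-intro p {i} pi = dec-true (any? λ i → p i ≟ᵇ true) (i , pi)

χᵇ-∃ᵇ≤Σ : ∀ k (p : Fin k → Bool) → χᵇ (∃ᵇ p) ≤ Σ[< k ] (λ i → χᵇ (p i))
χᵇ-∃ᵇ≤Σ k p with any? (λ i → p i ≟ᵇ true)
... | yes (i , pi) = subst (λ b → χᵇ b ≤ Σ[< k ] (λ i → χᵇ (p i))) pi (Σ-≥-term k (λ i → χᵇ (p i)) i)
... | no _ = z≤n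

Σ-χᵇ-false : ∀ k (p : Fin k → Bool) → (∀ i → p i ≡ false) → Σ[< k ] (λ i → χᵇ (p i)) ≡ 0
Σ-χᵇ-false k p p≡false = trans (Σ-cong k (λ i → cong χᵇ (p≡false i))) (Σ-0 k)

Σ-χᵇ-atMostOne : ∀ k (p : Fin k → Bool) → (∀ {i j} → p i ≡ true → p j ≡ true → i ≡ j) →
                 Σ[< k ] (λ i → χᵇ (p i)) ≤ 1
Σ-χᵇ-atMostOne zero p _ = z≤n
Σ-χᵇ-atMostOne (suc k) p unique with p zero in p0
... | false = Σ-χᵇ-atMostOne k (λ i → p (suc i)) λ pi pj → suc-injective (unique pi pj)
... | true = ≤-reflexive (cong suc (Σ-χᵇ-false k (λ i → p (suc i)) p-suc≡false))
  where
  p-suc≡false : ∀ i → p (suc i) ≡ false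
  p-suc≡false i with p (suc i) in psi
  ... | false = refl
  ... | true with () ← unique p0 psi

Σ-χᵇ-∃ᵇ-disjoint : ∀ t M (q : Fin t → Fin M → Bool) (b : Fin M → Bool) →
  (∀ i a → q i a ≡ true → b a ≡ true) → (∀ {i j} a → q i a ≡ true → q j a ≡ true → i ≡ j) →
  Σ[< t ] (λ i → χᵇ (∃ᵇ (q i))) ≤ Σ[< M ] (λ a → χᵇ (b a))
Σ-χᵇ-∃ᵇ-disjoint t M q b q⊆b disjoint = begin
  Σ[< t ] (λ i → χᵇ (∃ᵇ (q i)))                ≤⟨ Σ-mono t (λ i → χᵇ-∃ᵇ≤Σ M (q i)) ⟩
  Σ[< t ] (λ i → Σ[< M ] (λ a → χᵇ (q i a)))   ≡⟨ Σ-comm t M (λ i a → χᵇ (q i a)) ⟩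
  Σ[< M ] (λ a → Σ[< t ] (λ i → χᵇ (q i a)))   ≤⟨ Σ-mono M column≤b ⟩
  Σ[< M ] (λ a → χᵇ (b a))                     ∎
  where
  open ≤-Reasoning
  column≤b : ∀ a → Σ[< t ] (λ i → χᵇ (q i a)) ≤ χᵇ (b a)
  column≤b a with b a in ba
  ... | true = Σ-χᵇ-atMostOne t (λ i → q i a) (disjoint a)
  ... | false = ≤-reflexive (Σ-χᵇ-false t (λ i → q i a) q≡false)
    where
    q≡false : ∀ i → q i a ≡ false
    q≡false i with q i a in qia
    ... | false = refl
    ... | true with () ← trans (sym (q⊆b i a qia)) ba

≡true-ext : ∀ {a b} → (a ≡ true → b ≡ true) → (b ≡ true → a ≡ true) → a ≡ b
≡true-ext {false} {false} _ _ = refl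
≡true-ext {false} {true} _ b⇒a = b⇒a refl
≡true-ext {true} a⇒b _ = sym (a⇒b refl)

lookup≡true⇒∈ : ∀ {n} {p : Subset n} {x} → lookup p x ≡ true → x ∈ p
lookup≡true⇒∈ {p = p} {x} = lookup⇒[]= x p

∉⇒lookup≡false : ∀ {n} {p : Subset n} {x} → x ∉ p → lookup p x ≡ false
∉⇒lookup≡false {p = p} {x} x∉p with lookup p x in px
... | false = refl
... | true = contradiction (lookup≡true⇒∈ px) x∉p

disjoint-unique : ∀ {k M} (J : Fin k → Subset M) → (∀ i j → i ≢ j → ∀ a → a ∈ J i → a ∉ J j) →
                  ∀ {i j a} → lookup (J i) a ≡ true → lookup (J j) a ≡ true → i ≡ j
disjoint-unique J disjoint {i} {j} a∈Jᵢ a∈Jⱼ with i ≟ j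
... | yes i≡j = i≡j
... | no i≢j = contradiction (lookup≡true⇒∈ a∈Jⱼ) (disjoint i j i≢j _ (lookup≡true⇒∈ a∈Jᵢ))

∣p∣≡Σ : ∀ {n} (p : Subset n) → ∣ p ∣ ≡ Σ[< n ] (λ i → χᵇ (lookup p i))
∣p∣≡Σ [] = refl
∣p∣≡Σ (true ∷ p) = cong suc (∣p∣≡Σ p)
∣p∣≡Σ (false ∷ p) = ∣p∣≡Σ p

∣tabulate∣ : ∀ {n} (f : Fin n → Bool) → ∣ tabulate f ∣ ≡ Σ[< n ] (λ i → χᵇ (f i))
∣tabulate∣ {n} f = trans (∣p∣≡Σ (tabulate f)) (Σ-cong n (λ i → cong χᵇ (lookup∘tabulate f i)))

crosses : ∀ {n} → Subset n → Fin n → Fin n → Bool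
crosses U p q = lookup U p ∧ not (lookup U q)

crosses⇔ : ∀ {n} {U : Subset n} {p q} → crosses U p q ≡ true ⇔ (p ∈ U × q ∉ U)
crosses⇔ {U = U} {p} {q} = mk⇔ to from
  where
  to : crosses U p q ≡ true → p ∈ U × q ∉ U
  to c with lookup U p in pU | lookup U q in qU
  ... | true | false = lookup≡true⇒∈ pU , λ q∈U → contradiction (trans (sym ([]=⇒lookup q∈U)) qU) λ ()
  from : p ∈ U × q ∉ U → crosses U p q ≡ true
  from (p∈U , q∉U) rewrite []=⇒lookup p∈U | ∉⇒lookup≡false q∉U = refl

nonTrivial? : ∀ {n} (U : Subset n) → Dec (NonTrivial U)
nonTrivial? U = nonempty? U ×-dec any? (λ v → ¬? (v ∈? U))

NonTrivial-∁ : ∀ {n} {U : Subset n} → NonTrivial U → NonTrivial (∁ U)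
NonTrivial-∁ ((v , v∈U) , (w , w∉U)) = (w , x∉p⇒x∈∁p w∉U) , (v , λ v∈∁U → x∈∁p⇒x∉p v∈∁U v∈U)

module _ {A : Set} (P : A → Set) (cost : A → ℕ)
         (smaller? : ∀ a → Dec (∃ λ b → P b × cost b < cost a)) where

  cost-minimal : ∀ a → P a → ∃ λ b → P b × (∀ c → P c → cost b ≤ cost c)
  cost-minimal a Pa = descend (cost a) a Pa ≤-refl
    where
    descend : ∀ bound a → P a → cost a ≤ bound → ∃ λ b → P b × (∀ c → P c → cost b ≤ cost c)
    descend bound a Pa _ with smaller? a
    descend bound a Pa _ | no ∄smaller = a , Pa , λ c Pc → ≮⇒≥ λ c<a → ∄smaller (c , Pc , c<a)
    descend zero a Pa a≤0 | yes (b , _ , b<a) = contradiction (≤-trans b<a a≤0) λ ()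
    descend (suc bound) a Pa a≤1+bound | yes (b , Pb , b<a) =
      descend bound b Pb (≤-pred (≤-trans b<a a≤1+bound))

module Dicuts (D : Digraph) where
  open Digraph D

  leaving : Subset n → Fin m → Bool
  leaving U a = crosses U (tail a) (head a)

  Closed : Subset n → Set
  Closed U = ∀ a → ¬ Enters D a U

  enters? : ∀ a U → Dec (Enters D a U)
  enters? a U = ¬? (tail a ∈? U) ×-dec (head a ∈? U)

  closed? : ∀ U → Dec (Closed U)
  closed? U = all? λ a → ¬? (enters? a U)

  closed-or-entered : ∀ U → Closed U ⊎ ∃ λ a → Enters D a U
  closed-or-entered U with any? (λ a → enters? a U)
  ... | yes entered = inj₂ entered
  ... | no ∄entering = inj₁ λ a entering → ∄entering (a , entering)

  δ⁺ : Subset n → Subset m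
  δ⁺ U = tabulate (leaving U)

  outDegree : Subset n → ℕ
  outDegree U = Σ[< m ] (λ a → χᵇ (leaving U a))

  ∣δ⁺∣≡outDegree : ∀ U → ∣ δ⁺ U ∣ ≡ outDegree U
  ∣δ⁺∣≡outDegree U = ∣tabulate∣ (leaving U)

  ∈δ⁺⇔Leaves : ∀ {U a} → a ∈ δ⁺ U ⇔ Leaves D a U
  ∈δ⁺⇔Leaves {U} {a} = mk⇔
    (λ a∈δ⁺ → Equivalence.to crosses⇔ (trans (sym (lookup∘tabulate (leaving U) a)) ([]=⇒lookup a∈δ⁺)))
    (λ leaves → lookup≡true⇒∈ (trans (lookup∘tabulate (leaving U) a) (Equivalence.from crosses⇔ leaves)))

  δ⁺-isDicut : ∀ {U} → NonTrivial U → Closed U → IsDicut D (δ⁺ U)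
  δ⁺-isDicut {U} nt closed = U , nt , closed , λ a → Equivalence.to ∈δ⁺⇔Leaves , Equivalence.from ∈δ⁺⇔Leaves

  ∣dicut∣≡outDegree : ∀ {C} ((U , _) : IsDicut D C) → ∣ C ∣ ≡ outDegree U
  ∣dicut∣≡outDegree {C} (U , _ , _ , C≡δ⁺U) = trans (∣p∣≡Σ C) (Σ-cong m λ a → cong χᵇ (≡true-ext
    (λ a∈C → Equivalence.from crosses⇔ (proj₁ (C≡δ⁺U a) (lookup≡true⇒∈ a∈C)))
    (λ la → []=⇒lookup (proj₂ (C≡δ⁺U a) (Equivalence.to crosses⇔ la)))))

  DicutsAtLeast : ℕ → Set
  DicutsAtLeast t = ∀ U → NonTrivial U → Closed U → t ≤ outDegree U

  ≤∣dicut∣ : ∀ {t C} → DicutsAtLeast t → IsDicut D C → t ≤ ∣ C ∣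
  ≤∣dicut∣ atLeast dicut@(U , nt , closed , _) =
    subst (_ ≤_) (sym (∣dicut∣≡outDegree dicut)) (atLeast U nt closed)

  minimumDicut : HasDicut D → Σ (Subset n) λ U → (NonTrivial U × Closed U) × DicutsAtLeast (outDegree U)
  minimumDicut (_ , U , nt , closed , _) with cost-minimal Shore outDegree smaller? U (nt , closed)
    where
    Shore : Subset n → Set
    Shore U = NonTrivial U × Closed U
    smaller? : ∀ U → Dec (∃ λ W → Shore W × outDegree W < outDegree U)
    smaller? U = anySubset? λ W → (nonTrivial? W ×-dec closed? W) ×-dec (outDegree W <? outDegree U)
  ... | U₀ , shore , minimal = U₀ , shore , λ W nt closed → minimal W (nt , closed)

  disjointDijoins≤∣dicut∣ : ∀ {k C} → IsDicut D C → DisjointDijoins D k → k ≤ ∣ C ∣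
  disjointDijoins≤∣dicut∣ {k} {C} dicut (J , dijoin , disjoint) = begin
    k                                  ≡⟨ Σ-1 k ⟨
    Σ[< k ] (λ _ → 1)                  ≤⟨ Σ-mono k hits ⟩
    Σ[< k ] (λ i → χᵇ (∃ᵇ (inside i))) ≤⟨ Σ-χᵇ-∃ᵇ-disjoint k m inside (lookup C) (λ _ _ → ∧-conicalʳ _ _)
                                            (λ _ in-i in-j → disjoint-unique J disjoint (∧-conicalˡ _ _ in-i) (∧-conicalˡ _ _ in-j)) ⟩
    Σ[< m ] (λ a → χᵇ (lookup C a))    ≡⟨ sym (∣p∣≡Σ C) ⟩
    ∣ C ∣                              ∎
    where
    open ≤-Reasoning
    inside : Fin k → Fin m → Bool
    inside i a = lookup (J i) a ∧ lookup C a
    hits : ∀ i → 1 ≤ χᵇ (∃ᵇ (inside i))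
    hits i with a , a∈C , a∈Jᵢ ← dijoin i C dicut
      rewrite ∃ᵇ-intro (inside i) {a} (cong₂ _∧_ ([]=⇒lookup a∈Jᵢ) ([]=⇒lookup a∈C)) = ≤-refl

  minDicutEqualsMaxDijoins : (∀ t → DicutsAtLeast t → DisjointDijoins D t) → HasDicut D →
                             MinDicutEqualsMaxDijoins D
  minDicutEqualsMaxDijoins pack hasDicut with U₀ , (nt , closed) , minimal ← minimumDicut hasDicut =
    δ⁺ U₀ , dicut₀ , (λ _ → ≤∣dicut∣ atLeast) , pack _ atLeast , λ _ → disjointDijoins≤∣dicut∣ dicut₀
    where
    dicut₀ : IsDicut D (δ⁺ U₀)
    dicut₀ = δ⁺-isDicut nt closed
    atLeast : DicutsAtLeast ∣ δ⁺ U₀ ∣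
    atLeast = subst DicutsAtLeast (sym (∣δ⁺∣≡outDegree U₀)) minimal

-- Packing dijoins from SCO decompositions

crosses-∁ : ∀ {n} (U : Subset n) p q → crosses (∁ U) p q ≡ crosses U q p
crosses-∁ U p q rewrite lookup-map p not U | lookup-map q not U with lookup U p | lookup U q
... | true | true = refl
... | true | false = refl
... | false | true = refl
... | false | false = refl

module Packing (decompose : SCODecomposition) (D : Digraph) where
  open Digraph D
  open Dicuts D

  underlying : Graph
  underlying = record { n = n ; m = m ; u = tail ; v = head }

  weights : ℕ → Fin m → Bool → ℕ
  weights t _ true = t
  weights t _ false = 1

  outValue-weights : ∀ t U → outValue underlying (weights t) U ≡ t * outDegree U + outDegree (∁ U)
  outValue-weights t U = trans (Σ-distrib-+ m _ _) (cong₂ _+_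
    (trans (Σ-cong m λ a → if-then-0≡*χᵇ (leaving U a) t) (Σ-distribˡ-* m t _))
    (Σ-cong m λ a → cong χᵇ (sym (crosses-∁ U (tail a) (head a)))))

  outDegree-positive : ∀ {U a} → leaving U a ≡ true → 1 ≤ outDegree U
  outDegree-positive {U} {a} la = subst (λ b → χᵇ b ≤ outDegree U) la (Σ-≥-term m _ a)

  enters⇒leaves-∁ : ∀ {U a} → Enters D a U → leaving (∁ U) a ≡ true
  enters⇒leaves-∁ (tail∉U , head∈U) = Equivalence.from crosses⇔ (x∉p⇒x∈∁p tail∉U , x∈p⇒x∉∁p head∈U)

  enters-∁⇒leaves : ∀ {U a} → Enters D a (∁ U) → leaving U a ≡ true
  enters-∁⇒leaves (tail∉∁U , head∈∁U) = Equivalence.from crosses⇔ (x∉∁p⇒x∈p tail∉∁U , x∈∁p⇒x∉p head∈∁U)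

  -- If U or ∁ U is closed, its out-degree is at least 2 + s; otherwise both out-degrees are positive.
  weights-cut : ∀ s → DicutsAtLeast (2 + s) → ∀ U → NonTrivial U →
                2 + s ≤ outValue underlying (weights (suc s)) U
  weights-cut s atLeast U nt rewrite outValue-weights (suc s) U
    with closed-or-entered U | closed-or-entered (∁ U)
  ... | inj₁ closed | _ = ≤-trans (atLeast U nt closed) (≤-trans (m≤n*m _ (suc s)) (m≤m+n _ _))
  ... | inj₂ _ | inj₁ closed∁ = ≤-trans (atLeast (∁ U) (NonTrivial-∁ nt) closed∁) (m≤n+m _ _)
  ... | inj₂ (_ , entering) | inj₂ (_ , entering∁) = begin
    2 + s                                 ≡⟨ trans (+-comm 1 (suc s)) (cong (_+ 1) (sym (*-identityʳ (suc s)))) ⟩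
    suc s * 1 + 1                         ≤⟨ +-mono-≤ (*-monoʳ-≤ (suc s) (outDegree-positive {U} (enters-∁⇒leaves {U} entering∁)))
                                                      (outDegree-positive {∁ U} (enters⇒leaves-∁ {U} entering)) ⟩
    suc s * outDegree U + outDegree (∁ U) ∎
    where open ≤-Reasoning

  weights-isNZτSCO : ∀ s → DicutsAtLeast (2 + s) → IsNZτSCO underlying (2 + s) (weights (suc s))
  weights-isNZτSCO s atLeast =
    (λ { _ true → s≤s z≤n ; _ false → s≤s z≤n }) , (λ _ → +-comm (suc s) 1) , weights-cut s atLeast

  -- An SCO leaves ∁ U; when U is the shore of a dicut it can only do so along a reversed arc.
  reversed-isDijoin : ∀ {O} → IsSCO underlying O → IsDijoin D (tabulate λ a → O a false)
  reversed-isDijoin {O} (_ , strong) C (U , nt , closed , C≡δ⁺U) with strong (∁ U) (NonTrivial-∁ nt)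
  ... | a , true , _ , (tail∈∁U , head∉∁U) = contradiction (x∈∁p⇒x∉p tail∈∁U , x∉∁p⇒x∈p head∉∁U) (closed a)
  ... | a , false , Oa⁻ , (head∈∁U , tail∉∁U) =
    a , proj₂ (C≡δ⁺U a) (x∉∁p⇒x∈p tail∉∁U , x∈∁p⇒x∉p head∈∁U) ,
    lookup≡true⇒∈ (trans (lookup∘tabulate (λ a → O a false) a) Oa⁻)

  packing : ∀ t → DicutsAtLeast t → DisjointDijoins D t
  packing zero _ = (λ ()) , (λ ()) , λ ()
  packing (suc zero) atLeast = (λ _ → ⊤) , all-arcs , λ { zero zero 0≢0 → contradiction refl 0≢0 }
    where
    all-arcs : ∀ _ → IsDijoin D ⊤
    all-arcs _ C dicut with nonempty? C
    ... | yes (a , a∈C) = a , a∈C , ∈⊤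
    ... | no empty = contradiction
      (subst (1 ≤_) (trans (cong ∣_∣ (Empty-unique empty)) (∣⊥∣≡0 m)) (≤∣dicut∣ atLeast dicut)) λ ()
  packing t@(suc (suc s)) atLeast
    with O , sco , weights≡ΣO ← decompose underlying t (s≤s z≤n) (weights (suc s)) (weights-isNZτSCO s atLeast) =
    J , (λ i → reversed-isDijoin (sco i)) , disjoint
    where
    J : Fin t → Subset m
    J i = tabulate λ a → O i a false
    disjoint : ∀ i j → i ≢ j → ∀ a → a ∈ J i → a ∉ J j
    disjoint i j i≢j a a∈Jᵢ a∈Jⱼ = contradiction (begin
      2                                                        ≡⟨ cong₂ (λ b c → χᵇ b + χᵇ c) (sym (Oᵢa⁻ i a∈Jᵢ)) (sym (Oᵢa⁻ j a∈Jⱼ)) ⟩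
      χᵇ (O i a false) + χᵇ (O j a false)                      ≤⟨ Σ-≥-two-terms t (λ k → χᵇ (O k a false)) i≢j ⟩
      Σ[< t ] (λ k → χᵇ (O k a false))                         ≡⟨ weights≡ΣO a false ⟨
      1                                                        ∎) λ { (s≤s ()) }
      where
      open ≤-Reasoning
      Oᵢa⁻ : ∀ i → a ∈ J i → O i a false ≡ true
      Oᵢa⁻ i a∈Jᵢ = trans (sym (lookup∘tabulate (λ a → O i a false) a)) ([]=⇒lookup a∈Jᵢ)

decomposition⇒woodall : SCODecomposition → WoodallConjecture
decomposition⇒woodall decompose D = Dicuts.minDicutEqualsMaxDijoins D (Packing.packing decompose D)

-- SCO decompositions from packings of dijoins

↑ˡ≢↑ʳ : ∀ {a b} (i : Fin a) (j : Fin b) → i ↑ˡ b ≢ a ↑ʳ j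
↑ˡ≢↑ʳ {a} {b} i j i≡j with () ← trans (sym (splitAt-↑ˡ a i b)) (trans (cong (splitAt a) i≡j) (splitAt-↑ʳ a b j))

module Auxiliary (G : Graph) (τ : ℕ) (x : Fin (Graph.m G) → Bool → ℕ) (nzx : IsNZτSCO G τ x) where
  open Graph G

  x≥1 : ∀ e s → x e s ≥ 1
  x≥1 = proj₁ nzx

  x⁺+x⁻≡τ : ∀ e → x e true + x e false ≡ τ
  x⁺+x⁻≡τ = proj₁ (proj₂ nzx)

  x⁺<τ : ∀ e → x e true < τ
  x⁺<τ e = subst (x e true <_) (x⁺+x⁻≡τ e) (m<m+n (x e true) (x≥1 e false))

  node : Fin n → Fin (n + m)
  node p = p ↑ˡ m

  edgeNode : Fin m → Fin (n + m)
  edgeNode e = n ↑ʳ e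

  -- Of the τ arcs leaving edgeNode e, those with k < x e⁺ end in v e, the others in u e.
  towards : Fin m → Bool → Fin τ → Bool
  towards e true k = toℕ k <ᵇ x e true
  towards e false k = not (towards e true k)

  endpoint : Fin m → Fin τ → Fin n
  endpoint e k = if towards e true k then v e else u e

  auxiliary : Digraph
  auxiliary = record
    { n = n + m ; m = m * τ
    ; tail = λ a → edgeNode (quotient {m} τ a)
    ; head = λ a → node (endpoint (quotient {m} τ a) (remainder {m} τ a)) }

  open Dicuts auxiliary

  arc : Fin m → Fin τ → Fin (m * τ)
  arc = combine

  arc-quotient-remainder : ∀ a → arc (quotient {m} τ a) (remainder {m} τ a) ≡ a
  arc-quotient-remainder = combine-remQuot {m} τ

  tail-arc : ∀ e k → Digraph.tail auxiliary (arc e k) ≡ edgeNode e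
  tail-arc e k = cong (λ (e′ , _) → edgeNode e′) (remQuot-combine {m} {τ} e k)

  head-arc : ∀ e k → Digraph.head auxiliary (arc e k) ≡ node (endpoint e k)
  head-arc e k = cong (λ (e′ , k′) → node (endpoint e′ k′)) (remQuot-combine {m} {τ} e k)

  endpoint-towards : ∀ e s k → towards e s k ≡ true → endpoint e k ≡ arcHead G e s
  endpoint-towards e true k t rewrite t = refl
  endpoint-towards e false k t with towards e true k
  endpoint-towards e false k () | true
  ... | false = refl

  towards-witness : ∀ e s → ∃ λ k → towards e s k ≡ true
  towards-witness e true = fromℕ< (≤-<-trans z≤n (x⁺<τ e)) ,
    subst (λ c → (c <ᵇ x e true) ≡ true) (sym (toℕ-fromℕ< _)) (dec-true (0 <? x e true) (x≥1 e true))
  towards-witness e false = fromℕ< (x⁺<τ e) ,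
    subst (λ c → not (c <ᵇ x e true) ≡ true) (sym (toℕ-fromℕ< _)) (cong not (dec-false (x e true <? x e true) (n≮n _)))

  Σ-towards : ∀ e s → Σ[< τ ] (λ k → χᵇ (towards e s k)) ≡ x e s
  Σ-towards e true = Σ-χᵇ-<ᵇ τ (x e true) (<⇒≤ (x⁺<τ e))
  Σ-towards e false = +-cancelˡ-≡ (x e true) _ _ (begin
    x e true + Σ⁻ ≡⟨ cong (_+ Σ⁻) (Σ-towards e true) ⟨
    Σ⁺ + Σ⁻       ≡⟨ Σ-χᵇ+Σ-χᵇ-not τ (towards e true) ⟩
    τ             ≡⟨ x⁺+x⁻≡τ e ⟨
    x e true + x e false ∎)
    where
    open ≡-Reasoning
    Σ⁺ Σ⁻ : ℕ
    Σ⁺ = Σ[< τ ] (λ k → χᵇ (towards e true k))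
    Σ⁻ = Σ[< τ ] (λ k → χᵇ (towards e false k))

  arcHead-not : ∀ e s → arcHead G e (not s) ≡ arcTail G e s
  arcHead-not e true = refl
  arcHead-not e false = refl

  arcsLeaving : Subset (n + m) → Fin m → ℕ
  arcsLeaving U e = Σ[< τ ] (λ k → χᵇ (crosses U (edgeNode e) (node (endpoint e k))))

  outDegree-by-edges : ∀ U → outDegree U ≡ Σ[< m ] (arcsLeaving U)
  outDegree-by-edges U = trans (Σ-combine m τ _) (Σ-cong m λ e → Σ-cong τ λ k →
    cong χᵇ (cong₂ (crosses U) (tail-arc e k) (head-arc e k)))

  arcsLeaving≤outDegree : ∀ U e → arcsLeaving U e ≤ outDegree U
  arcsLeaving≤outDegree U e = subst (arcsLeaving U e ≤_) (sym (outDegree-by-edges U)) (Σ-≥-term m (arcsLeaving U) e)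

  edgeNode-closure : ∀ {U} → Closed U → ∀ e k → node (endpoint e k) ∈ U → edgeNode e ∈ U
  edgeNode-closure {U} closed e k endpoint∈U with edgeNode e ∈? U
  ... | yes edge∈U = edge∈U
  ... | no edge∉U = contradiction
    (subst (_∉ U) (sym (tail-arc e k)) edge∉U , subst (_∈ U) (sym (head-arc e k)) endpoint∈U) (closed (arc e k))

  restrict : Subset (n + m) → Subset n
  restrict U = tabulate λ p → lookup U (node p)

  ∈restrict⇔ : ∀ {U p} → p ∈ restrict U ⇔ node p ∈ U
  ∈restrict⇔ {U} {p} = mk⇔
    (λ p∈ → lookup≡true⇒∈ (trans (sym (lookup∘tabulate (λ p → lookup U (node p)) p)) ([]=⇒lookup p∈)))
    (λ node∈ → lookup≡true⇒∈ (trans (lookup∘tabulate (λ p → lookup U (node p)) p) ([]=⇒lookup node∈)))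

  leaving-edge : ∀ {U} → Closed U → ∀ e s → LeavesG G e s (restrict U) → x e s ≤ arcsLeaving U e
  leaving-edge {U} closed e s (tail∈ , head∉) = begin
    x e s                                       ≡⟨ Σ-towards e s ⟨
    Σ[< τ ] (λ k → χᵇ (towards e s k))          ≤⟨ Σ-mono τ (λ k → χᵇ-mono (arc-leaves k)) ⟩
    arcsLeaving U e                             ∎
    where
    open ≤-Reasoning
    edge∈U : edgeNode e ∈ U
    edge∈U with k , other-side ← towards-witness e (not s) = edgeNode-closure closed e k
      (subst (λ p → node p ∈ U) (sym (trans (endpoint-towards e (not s) k other-side) (arcHead-not e s)))
        (Equivalence.to ∈restrict⇔ tail∈))
    arc-leaves : ∀ k → towards e s k ≡ true → crosses U (edgeNode e) (node (endpoint e k)) ≡ true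
    arc-leaves k this-side = Equivalence.from crosses⇔ (edge∈U ,
      subst (λ p → node p ∉ U) (sym (endpoint-towards e s k this-side)) (λ node∈ → head∉ (Equivalence.from ∈restrict⇔ node∈)))

  edge-bound : ∀ {U} → Closed U → ∀ e →
    (if crosses (restrict U) (u e) (v e) then x e true else 0) +
    (if crosses (restrict U) (v e) (u e) then x e false else 0) ≤ arcsLeaving U e
  edge-bound {U} closed e with crosses (restrict U) (u e) (v e) in c⁺ | crosses (restrict U) (v e) (u e) in c⁻
  ... | false | false = z≤n
  ... | true | false = subst (_≤ arcsLeaving U e) (sym (+-identityʳ _)) (leaving-edge closed e true (Equivalence.to crosses⇔ c⁺))
  ... | false | true = leaving-edge closed e false (Equivalence.to crosses⇔ c⁻)
  ... | true | true = contradiction (proj₁ (Equivalence.to (crosses⇔ {U = restrict U}) c⁻)) (proj₂ (Equivalence.to crosses⇔ c⁺))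

  outValue≤outDegree : ∀ {U} → Closed U → outValue G x (restrict U) ≤ outDegree U
  outValue≤outDegree {U} closed = ≤-trans (Σ-mono m (edge-bound closed)) (≤-reflexive (sym (outDegree-by-edges U)))

  node-or-edgeNode : ∀ z → (∃ λ p → node p ≡ z) ⊎ (∃ λ e → edgeNode e ≡ z)
  node-or-edgeNode z with splitAt n z in eq
  ... | inj₁ p = inj₁ (p , splitAt⁻¹-↑ˡ eq)
  ... | inj₂ e = inj₂ (e , splitAt⁻¹-↑ʳ eq)

  -- Either the shore meets V properly and the cut condition on x applies, or it contains
  -- some edge node but no vertex node (all τ arcs of that edge node leave), or it contains
  -- every vertex node, and then by closure every edge node too, which is impossible.
  auxiliary-dicutsAtLeast : DicutsAtLeast τ
  auxiliary-dicutsAtLeast U ((z , z∈U) , (z′ , z′∉U)) closed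
    with nonempty? (restrict U) | any? (λ p → ¬? (p ∈? restrict U))
  ... | yes some | yes missing = ≤-trans (proj₂ (proj₂ nzx) (restrict U) (some , missing)) (outValue≤outDegree closed)
  ... | no none | _ with node-or-edgeNode z
  ...   | inj₁ (p , refl) = contradiction (p , Equivalence.from ∈restrict⇔ z∈U) none
  ...   | inj₂ (e , refl) = ≤-trans all-arcs-leave (arcsLeaving≤outDegree U e)
    where
    all-arcs-leave : τ ≤ arcsLeaving U e
    all-arcs-leave = subst (_≤ arcsLeaving U e) (Σ-1 τ) (Σ-mono τ λ k →
      χᵇ-mono {true} λ _ → Equivalence.from crosses⇔ (z∈U , λ node∈ → none (endpoint e k , Equivalence.from ∈restrict⇔ node∈)))
  auxiliary-dicutsAtLeast U ((z , z∈U) , (z′ , z′∉U)) closed | yes _ | no ∄missing with node-or-edgeNode z′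
  ... | inj₁ (p , refl) = contradiction (p , λ p∈ → z′∉U (Equivalence.to ∈restrict⇔ p∈)) ∄missing
  ... | inj₂ (e , refl) with k , _ ← towards-witness e true =
    contradiction (edgeNode-closure closed e k (Equivalence.to ∈restrict⇔
      (decidable-stable (endpoint e k ∈? restrict U) λ ∉ → ∄missing (endpoint e k , ∉)))) z′∉U

  star : Fin m → Subset (n + m)
  star e = ⁅ edgeNode e ⁆

  star-isDicut : ∀ e → IsDicut auxiliary (δ⁺ (star e))
  star-isDicut e = δ⁺-isDicut
    ((edgeNode e , x∈⁅x⁆ _) , (node (u e) , λ u∈star → ↑ˡ≢↑ʳ (u e) e (x∈⁅y⁆⇒x≡y _ u∈star)))
    (λ a (_ , head∈star) → ↑ˡ≢↑ʳ _ e (x∈⁅y⁆⇒x≡y _ head∈star))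

  ∈δ⁺-star : ∀ {e a} → a ∈ δ⁺ (star e) → arc e (remainder {m} τ a) ≡ a
  ∈δ⁺-star {e} {a} a∈δ⁺ = trans (cong (λ e′ → arc e′ (remainder {m} τ a)) (sym quotient≡e)) (arc-quotient-remainder a)
    where
    quotient≡e : quotient {m} τ a ≡ e
    quotient≡e = ↑ʳ-injective n _ e (x∈⁅y⁆⇒x≡y _ (proj₁ (Equivalence.to ∈δ⁺⇔Leaves a∈δ⁺)))

  touches : Subset n → Fin m → Bool
  touches U e = lookup U (u e) ∨ lookup U (v e)

  lift : Subset n → Subset (n + m)
  lift U = U ++ tabulate (touches U)

  lookup-lift-node : ∀ U p → lookup (lift U) (node p) ≡ lookup U p
  lookup-lift-node U p = lookup-++ˡ U _ p

  lookup-lift-edgeNode : ∀ U e → lookup (lift U) (edgeNode e) ≡ touches U e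
  lookup-lift-edgeNode U e = trans (lookup-++ʳ U _ e) (lookup∘tabulate (touches U) e)

  lift-nonTrivial : ∀ {U} → NonTrivial U → NonTrivial (lift U)
  lift-nonTrivial {U} ((p , p∈U) , (q , q∉U)) =
    (node p , lookup≡true⇒∈ (trans (lookup-lift-node U p) ([]=⇒lookup p∈U))) ,
    (node q , λ q∈lift → q∉U (lookup≡true⇒∈ (trans (sym (lookup-lift-node U q)) ([]=⇒lookup q∈lift))))

  endpoint∈⇒touches : ∀ U e k → lookup U (endpoint e k) ≡ true → touches U e ≡ true
  endpoint∈⇒touches U e k with towards e true k
  ... | true = λ v∈U → trans (cong (lookup U (u e) ∨_) v∈U) (∨-zeroʳ _)
  ... | false = λ u∈U → cong (_∨ lookup U (v e)) u∈U

  lift-closed : ∀ U → Closed (lift U)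
  lift-closed U a (tail∉lift , head∈lift) = tail∉lift (lookup≡true⇒∈ (trans (lookup-lift-edgeNode U e)
    (endpoint∈⇒touches U e k (trans (sym (lookup-lift-node U (endpoint e k))) ([]=⇒lookup head∈lift)))))
    where
    e : Fin m
    e = quotient {m} τ a
    k : Fin τ
    k = remainder {m} τ a

  other-endpoint : ∀ {U} e s → touches U e ≡ true → arcHead G e s ∉ U → arcTail G e s ∈ U
  other-endpoint {U} e true either v∉U with lookup U (u e) in uU
  ... | true = lookup≡true⇒∈ uU
  ... | false = contradiction (lookup≡true⇒∈ either) v∉U
  other-endpoint {U} e false either u∉U with lookup U (v e) in vU
  ... | true = lookup≡true⇒∈ vU
  ... | false rewrite ∉⇒lookup≡false u∉U = contradiction either λ ()

  towards-own-side : ∀ e k → towards e (towards e true k) k ≡ true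
  towards-own-side e k with towards e true k in t
  ... | true = t
  ... | false rewrite t = refl

  module Orientation (J : Fin τ → Subset (m * τ)) (dijoin : ∀ i → IsDijoin auxiliary (J i))
                     (disjoint : ∀ i j → i ≢ j → ∀ a → a ∈ J i → a ∉ J j) where

    uses : Fin τ → Fin m → Bool → Bool
    uses i e s = ∃ᵇ λ k → lookup (J i) (arc e k) ∧ towards e s k

    uses-intro : ∀ {i e s k} → arc e k ∈ J i → towards e s k ≡ true → uses i e s ≡ true
    uses-intro {i} {e} {s} {k} arc∈J this-side =
      ∃ᵇ-intro (λ k → lookup (J i) (arc e k) ∧ towards e s k) (cong₂ _∧_ ([]=⇒lookup arc∈J) this-side)

    orientation : Fin τ → Fin m → Bool → Bool
    orientation i e true = uses i e true
    orientation i e false = not (uses i e true)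

    Σ-uses≤x : ∀ e s → Σ[< τ ] (λ i → χᵇ (uses i e s)) ≤ x e s
    Σ-uses≤x e s = subst (Σ[< τ ] (λ i → χᵇ (uses i e s)) ≤_) (Σ-towards e s)
      (Σ-χᵇ-∃ᵇ-disjoint τ τ (λ i k → lookup (J i) (arc e k) ∧ towards e s k) (towards e s) (λ _ _ → ∧-conicalʳ _ _)
      λ k in-i in-j → disjoint-unique J disjoint (∧-conicalˡ _ _ in-i) (∧-conicalˡ _ _ in-j))

    -- Every dijoin meets the star dicut of e, so it uses e on at least one side.
    orientation⁻≤uses⁻ : ∀ e i → χᵇ (orientation i e false) ≤ χᵇ (uses i e false)
    orientation⁻≤uses⁻ e i = χᵇ-mono λ not-uses⁺ → star-hit not-uses⁺ (dijoin i _ (star-isDicut e))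
      where
      star-hit : not (uses i e true) ≡ true → (∃ λ a → a ∈ δ⁺ (star e) × a ∈ J i) → uses i e false ≡ true
      star-hit not-uses⁺ (a , a∈δ⁺ , a∈J) = by-side (subst (_∈ J i) (sym (∈δ⁺-star a∈δ⁺)) a∈J)
        where
        by-side : ∀ {k} → arc e k ∈ J i → uses i e false ≡ true
        by-side {k} arc∈J with towards e true k in t
        ... | true = contradiction (trans (sym not-uses⁺) (cong not (uses-intro {s = true} arc∈J t))) λ ()
        ... | false = uses-intro {s = false} arc∈J (cong not t)

    orientation-counts : ∀ e → Σ[< τ ] (λ i → χᵇ (orientation i e true)) ≡ x e true ×
                               Σ[< τ ] (λ i → χᵇ (orientation i e false)) ≡ x e false
    orientation-counts e = +-mono-≤-tight (Σ-uses≤x e true)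
      (≤-trans (Σ-mono τ (orientation⁻≤uses⁻ e)) (Σ-uses≤x e false))
      (≤-reflexive (trans (x⁺+x⁻≡τ e) (sym (Σ-χᵇ+Σ-χᵇ-not τ (λ i → uses i e true)))))

    -- A dijoin uses e on at most one side: the pointwise bound orientation⁻≤uses⁻ is tight.
    uses⇒orientation : ∀ i e s → uses i e s ≡ true → orientation i e s ≡ true
    uses⇒orientation i e true uses⁺ = uses⁺
    uses⇒orientation i e false uses⁻ = trans (χᵇ-injective χ-equal) uses⁻
      where
      χ-equal : χᵇ (orientation i e false) ≡ χᵇ (uses i e false)
      χ-equal = Σ-mono-tight τ (orientation⁻≤uses⁻ e)
        (≤-trans (Σ-uses≤x e false) (≤-reflexive (sym (proj₂ (orientation-counts e))))) i

    orientation-strong : ∀ i U → NonTrivial U →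
                         Σ (Fin m) λ e → Σ Bool λ s → (orientation i e s ≡ true) × LeavesG G e s U
    orientation-strong i U nt with a , a∈δ⁺ , a∈J ← dijoin i _ (δ⁺-isDicut (lift-nonTrivial nt) (lift-closed U)) =
      e , s , uses⇒orientation i e s (uses-intro {s = s} arc∈J (towards-own-side e k)) ,
      other-endpoint {U} e s (trans (sym (lookup-lift-edgeNode U e)) ([]=⇒lookup tail∈lift)) head∉U , head∉U
      where
      e : Fin m
      e = quotient {m} τ a
      k : Fin τ
      k = remainder {m} τ a
      s : Bool
      s = towards e true k
      arc∈J : arc e k ∈ J i
      arc∈J = subst (_∈ J i) (sym (arc-quotient-remainder a)) a∈J
      leaves : Leaves auxiliary a (lift U)
      leaves = Equivalence.to ∈δ⁺⇔Leaves a∈δ⁺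
      tail∈lift : edgeNode e ∈ lift U
      tail∈lift = proj₁ leaves
      head∉U : arcHead G e s ∉ U
      head∉U rewrite sym (endpoint-towards e s k (towards-own-side e k)) = λ endpoint∈U →
        proj₂ leaves (lookup≡true⇒∈ (trans (lookup-lift-node U _) ([]=⇒lookup endpoint∈U)))

    decomposition : DecomposesIntoSCOs G τ x
    decomposition = orientation , (λ i → (λ e → not-¬ refl) , orientation-strong i) , λ where
      e true → sym (proj₁ (orientation-counts e))
      e false → sym (proj₂ (orientation-counts e))

DisjointDijoins-≤ : ∀ D {k l} → k ≤ l → DisjointDijoins D l → DisjointDijoins D k
DisjointDijoins-≤ D k≤l (J , dijoin , disjoint) =
  (λ i → J (inject≤ i k≤l)) , (λ i → dijoin (inject≤ i k≤l)) ,
  λ i j i≢j → disjoint _ _ λ eq → i≢j (inject≤-injective k≤l k≤l i j eq)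

decomposition-without-edges : ∀ G τ → τ > 0 → ∀ x → IsNZτSCO G τ x → ¬ Fin (Graph.m G) → DecomposesIntoSCOs G τ x
decomposition-without-edges G τ τ>0 x (_ , _ , cut) no-edge =
  (λ _ e → contradiction e no-edge) ,
  (λ _ → (λ e → contradiction e no-edge) ,
         λ U nt → contradiction (proj₁ (Σ-positive (Graph.m G) _ (≤-trans τ>0 (cut U nt)))) no-edge) ,
  λ e → contradiction e no-edge

inhabited? : ∀ k → Dec (Fin k)
inhabited? zero = no λ ()
inhabited? (suc k) = yes zero

woodall⇒decomposition : WoodallConjecture → SCODecomposition
woodall⇒decomposition woodall G τ τ>0 x nzx with inhabited? (Graph.m G)
... | no no-edge = decomposition-without-edges G τ τ>0 x nzx no-edge
... | yes e =
  let open Auxiliary G τ x nzx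
      (_ , dicut , _ , packing , _) = woodall auxiliary (_ , star-isDicut e)
      (J , dijoin , disjoint) = DisjointDijoins-≤ auxiliary (Dicuts.≤∣dicut∣ auxiliary auxiliary-dicutsAtLeast dicut) packing
  in Orientation.decomposition J dijoin disjoint

theorem11 : WoodallConjecture ⇔ SCODecomposition
theorem11 = mk⇔ woodall⇒decomposition decomposition⇒woodall
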